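{- Let $p,q,\ell,n$ be positive integers with $p\le q\le \ell$ and $\gcd(p,q,\ell)=1$. Let $N(p,q,\ell,n)$ denote the number of ordered triples $(x,y,z)$ of nonnegative integers with $px+qy+\ell z=n$. Let $u=\gcd(p,q)$ and $A=\{p/u,\,q/u\}$. Then \[ N(p,q,\ell,n)=\sum_{k=0}^{\left\lfloor \frac{n-j\ell}{u\ell}\right\rfloor} p_A\!\left(\frac{n-j\ell}{u}-\ell k\right), \] where $j\in\{0,1,\ldots,u-1\}$ satisfies $n-\ell j\equiv 0 \pmod u$ (an empty sum being $0$).
   Context: For a set $A=\{a,b\}$ of relatively prime positive integers and an integer $m\ge 0$, $p_A(m)$ denotes the number of partitions of $m$ with all parts in $A$, i.e. the number of pairs $(x,y)$ of nonnegative integers with $ax+by=m$. -}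

module Defs where

open import Data.Nat using (ℕ; zero; suc; _+_; _*_; _∸_; _≤?_; _≟_)
open import Data.Nat.DivMod using (_/_)
open import Data.List using (List; length; filter; upTo; cartesianProduct; map)
open import Data.Nat.ListAction using (sum)
open import Data.Product using (_×_; _,_)
open import Relation.Nullary.Decidable using (does)
open import Data.Bool using (if_then_else_)

_div_ : ℕ → ℕ → ℕ
m div zero  = 0
m div suc k = m / suc k

-- p_A(m) for A = {a , b}: number of pairs (x , y) ∈ ℕ² with a x + b y = m.
-- For a, b ≥ 1 every solution has x , y ≤ m, so enumerating 0..m is exhaustive.
pA : ℕ → ℕ → ℕ → ℕ
pA a b m = length (filter (λ xy → let (x , y) = xy in a * x + b * y ≟ m)
                          (cartesianProduct (upTo (suc m)) (upTo (suc m))))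

-- N(p,q,ℓ,n): number of triples (x,y,z) ∈ ℕ³ with p x + q y + ℓ z = n
-- (for positive p,q,ℓ all solutions have coordinates ≤ n).
N : ℕ → ℕ → ℕ → ℕ → ℕ
N p q ℓ n = length (filter (λ t → let (x , y , z) = t in p * x + q * y + ℓ * z ≟ n)
                          (cartesianProduct (upTo (suc n))
                             (cartesianProduct (upTo (suc n)) (upTo (suc n)))))

sumTo : ℕ → (ℕ → ℕ) → ℕ
sumTo K f = sum (map f (upTo (suc K)))

-- When n < jℓ the upper limit is a negative integer, so the sum is
-- empty (= 0); when jℓ ≤ n all quantities are natural numbers and truncated
-- subtraction is exact (ℓ k ≤ (n - jℓ)/u for k in range).
RHS : (u a b ℓ n j : ℕ) → ℕ
RHS u a b ℓ n j =
  if does (ℓ * j ≤? n)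
  then sumTo ((n ∸ ℓ * j) div (u * ℓ)) (λ k → pA a b ((n ∸ ℓ * j) div u ∸ ℓ * k))
  else 0

-- Write p = a u and q = b u with u = gcd(p, q).  A solution of a u x + b u y + ℓ z = n
-- has ℓ z ≡ n ≡ ℓ j (mod u), hence z = k u + j because ℓ is invertible mod u.  With
-- n = m u + ℓ j the equation becomes a x + b y = m - ℓ k, which has p_A(m - ℓ k)
-- solutions when ℓ k ≤ m, i.e. when k ≤ ⌊m/ℓ⌋ = ⌊(n - ℓ j)/(u ℓ)⌋, and none otherwise.
module Submission where

open import Defs
open import Data.Nat
open import Data.Nat.Properties
open import Data.Nat.DivMod hiding (_div_)
open import Data.Nat.Divisibility using (divides; ∣⇒≤; >⇒∤) renaming (_∣_ to _∣ℕ_)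
open import Data.Nat.GCD using (gcd; gcd[m,n]∣m; gcd[m,n]∣n; gcd[m,n]≢0)
open import Data.Nat.Coprimality using (Coprime; coprime-divisor; gcd≡1⇒coprime)
open import Data.Nat.ListAction using (sum)
open import Data.Nat.ListAction.Properties using (sum-++)
open import Data.Nat.Tactic.RingSolver using (solve-∀)
open import Algebra.Properties.CommutativeSemigroup +-commutativeSemigroup using (interchange)
open import Data.Integer using (+_; _-_; _⊖_; ∣_∣)
open import Data.Integer.Properties using (m-n≡m⊖n; ∣m⊖n∣≡∣n⊖m∣; ∣⊖∣-≤; ∣i-j∣≡∣j-i∣)
open import Data.Integer.Divisibility using (_∣_)
open import Data.List using (List; []; _∷_; _++_; length; filter; upTo; applyUpTo; cartesianProduct; map)
open import Data.List.Properties using (map-++; map-∘; map-applyUpTo)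
open import Data.Product using (_×_; _,_; proj₁; proj₂)
open import Data.Sum using (inj₁; inj₂)
open import Data.Bool using (if_then_else_; true; false)
open import Function using (_∘_; _⇔_; mk⇔; Equivalence)
open import Relation.Nullary using (Dec; does; ¬_; yes; no; contradiction)
open import Relation.Nullary.Decidable using (does-⇔; dec-true; dec-false)
open import Relation.Unary using (Pred; Decidable)
open import Relation.Binary.PropositionalEquality

∑ : ℕ → (ℕ → ℕ) → ℕ
∑ zero    f = 0
∑ (suc n) f = f 0 + ∑ n (f ∘ suc)

∑-cong : ∀ n {f g} → (∀ i → i < n → f i ≡ g i) → ∑ n f ≡ ∑ n g
∑-cong zero    f≡g = refl
∑-cong (suc n) f≡g = cong₂ _+_ (f≡g 0 z<s) (∑-cong n λ i i<n → f≡g (suc i) (s<s i<n))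

∑-zero : ∀ n {f} → (∀ i → i < n → f i ≡ 0) → ∑ n f ≡ 0
∑-zero zero    f≡0 = refl
∑-zero (suc n) f≡0 = cong₂ _+_ (f≡0 0 z<s) (∑-zero n λ i i<n → f≡0 (suc i) (s<s i<n))

∑-distrib-+ : ∀ n f g → ∑ n (λ i → f i + g i) ≡ ∑ n f + ∑ n g
∑-distrib-+ zero    f g = refl
∑-distrib-+ (suc n) f g = begin
  f 0 + g 0 + ∑ n (λ i → f (suc i) + g (suc i))
    ≡⟨ cong (λ t → f 0 + g 0 + t) (∑-distrib-+ n (f ∘ suc) (g ∘ suc)) ⟩
  f 0 + g 0 + (∑ n (f ∘ suc) + ∑ n (g ∘ suc))
    ≡⟨ interchange (f 0) (g 0) (∑ n (f ∘ suc)) (∑ n (g ∘ suc)) ⟩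
  f 0 + ∑ n (f ∘ suc) + (g 0 + ∑ n (g ∘ suc))    ∎
  where open ≡-Reasoning

∑-swap : ∀ m n (f : ℕ → ℕ → ℕ) → ∑ m (λ i → ∑ n (f i)) ≡ ∑ n (λ k → ∑ m (λ i → f i k))
∑-swap zero    n f = sym (∑-zero n λ _ _ → refl)
∑-swap (suc m) n f = begin
  ∑ n (f 0) + ∑ m (λ i → ∑ n (f (suc i)))  ≡⟨ cong (λ t → ∑ n (f 0) + t) (∑-swap m n (f ∘ suc)) ⟩
  ∑ n (f 0) + ∑ n (λ k → ∑ m (λ i → f (suc i) k)) ≡⟨ ∑-distrib-+ n (f 0) _ ⟨
  ∑ n (λ k → f 0 k + ∑ m (λ i → f (suc i) k)) ∎
  where open ≡-Reasoning

∑-split : ∀ m n f → ∑ (m + n) f ≡ ∑ m f + ∑ n (λ i → f (m + i))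
∑-split zero    n f = refl
∑-split (suc m) n f = trans (cong (λ t → f 0 + t) (∑-split m n (f ∘ suc))) (sym (+-assoc (f 0) _ _))

∑-truncate : ∀ {m n f} → m ≤ n → (∀ i → m ≤ i → f i ≡ 0) → ∑ n f ≡ ∑ m f
∑-truncate {m} {n} {f} m≤n f≡0 = begin
  ∑ n f                                  ≡⟨ cong (λ k → ∑ k f) (m+[n∸m]≡n m≤n) ⟨
  ∑ (m + (n ∸ m)) f                      ≡⟨ ∑-split m (n ∸ m) f ⟩
  ∑ m f + ∑ (n ∸ m) (λ i → f (m + i))
    ≡⟨ cong (λ t → ∑ m f + t) (∑-zero (n ∸ m) λ i _ → f≡0 (m + i) (m≤m+n m i)) ⟩
  ∑ m f + 0                              ≡⟨ +-identityʳ _ ⟩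
  ∑ m f                                  ∎
  where open ≡-Reasoning

∑-blocks : ∀ m u f → ∑ (m * u) f ≡ ∑ m (λ k → ∑ u (λ r → f (k * u + r)))
∑-blocks zero    u f = refl
∑-blocks (suc m) u f = begin
  ∑ (u + m * u) f                                      ≡⟨ ∑-split u (m * u) f ⟩
  ∑ u f + ∑ (m * u) (λ i → f (u + i))                  ≡⟨ cong (λ t → ∑ u f + t) (∑-blocks m u _) ⟩
  ∑ u f + ∑ m (λ k → ∑ u (λ r → f (u + (k * u + r))))
    ≡⟨ cong (λ t → ∑ u f + t) (∑-cong m λ k _ → ∑-cong u λ r _ → cong f (+-assoc u (k * u) r)) ⟨
  ∑ u f + ∑ m (λ k → ∑ u (λ r → f (u + k * u + r)))    ∎
  where open ≡-Reasoning

∑-single : ∀ {n f} j → j < n → (∀ i → i < n → i ≢ j → f i ≡ 0) → ∑ n f ≡ f j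
∑-single {suc n} {f} zero    _ f≡0 =
  trans (cong (λ t → f 0 + t) (∑-zero n λ i i<n → f≡0 (suc i) (s<s i<n) λ ())) (+-identityʳ (f 0))
∑-single {suc n} {f} (suc j) (s<s j<n) f≡0 =
  cong₂ _+_ (f≡0 0 z<s λ ()) (∑-single j j<n λ i i<n i≢j → f≡0 (suc i) (s<s i<n) (i≢j ∘ suc-injective))

∑-residue : ∀ {u j f} m → j < u → (∀ k r → r < u → r ≢ j → f (k * u + r) ≡ 0) →
            ∑ (m * u) f ≡ ∑ m (λ k → f (k * u + j))
∑-residue {u} {j} {f} m j<u f≡0 = trans (∑-blocks m u f)
  (∑-cong m λ k _ → ∑-single j j<u λ r r<u r≢j → f≡0 k r r<u r≢j)

sum-applyUpTo : ∀ f n → sum (applyUpTo f n) ≡ ∑ n f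
sum-applyUpTo f zero    = refl
sum-applyUpTo f (suc n) = cong (λ t → f 0 + t) (sum-applyUpTo (f ∘ suc) n)

sum-map-upTo : ∀ (f : ℕ → ℕ) n → sum (map f (upTo n)) ≡ ∑ n f
sum-map-upTo f n = trans (cong sum (map-applyUpTo (λ i → i) f n)) (sum-applyUpTo f n)

sum-map-cartesianProduct : ∀ {A B : Set} (f : A × B → ℕ) xs ys →
  sum (map f (cartesianProduct xs ys)) ≡ sum (map (λ x → sum (map (λ y → f (x , y)) ys)) xs)
sum-map-cartesianProduct f []       ys = refl
sum-map-cartesianProduct f (x ∷ xs) ys = begin
  sum (map f (map (x ,_) ys ++ cartesianProduct xs ys))          ≡⟨ cong sum (map-++ f (map (x ,_) ys) _) ⟩
  sum (map f (map (x ,_) ys) ++ map f (cartesianProduct xs ys))  ≡⟨ sum-++ (map f (map (x ,_) ys)) _ ⟩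
  sum (map f (map (x ,_) ys)) + sum (map f (cartesianProduct xs ys))
    ≡⟨ cong₂ _+_ (cong sum (sym (map-∘ ys))) (sum-map-cartesianProduct f xs ys) ⟩
  sum (map (λ y → f (x , y)) ys) + sum (map (λ x → sum (map (λ y → f (x , y)) ys)) xs) ∎
  where open ≡-Reasoning

sum-map-upTo² : ∀ (f : ℕ × ℕ → ℕ) m n →
  sum (map f (cartesianProduct (upTo m) (upTo n))) ≡ ∑ m (λ x → ∑ n (λ y → f (x , y)))
sum-map-upTo² f m n = begin
  sum (map f (cartesianProduct (upTo m) (upTo n)))             ≡⟨ sum-map-cartesianProduct f (upTo m) (upTo n) ⟩
  sum (map (λ x → sum (map (λ y → f (x , y)) (upTo n))) (upTo m)) ≡⟨ sum-map-upTo _ m ⟩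
  ∑ m (λ x → sum (map (λ y → f (x , y)) (upTo n)))           ≡⟨ ∑-cong m (λ x _ → sum-map-upTo _ n) ⟩
  ∑ m (λ x → ∑ n (λ y → f (x , y)))                           ∎
  where open ≡-Reasoning

𝟙 : ∀ {a} {A : Set a} → Dec A → ℕ
𝟙 a? = if does a? then 1 else 0

𝟙-cong : ∀ {A B : Set} → A ⇔ B → (a? : Dec A) (b? : Dec B) → 𝟙 a? ≡ 𝟙 b?
𝟙-cong A⇔B a? b? = cong (λ t → if t then 1 else 0) (does-⇔ A⇔B a? b?)

𝟙-no : ∀ {A : Set} → ¬ A → (a? : Dec A) → 𝟙 a? ≡ 0
𝟙-no ¬a a? = cong (λ t → if t then 1 else 0) (dec-false a? ¬a)

length-filter≡sum-𝟙 : ∀ {A : Set} {p} {P : Pred A p} (P? : Decidable P) xs →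
  length (filter P? xs) ≡ sum (map (𝟙 ∘ P?) xs)
length-filter≡sum-𝟙 P? []       = refl
length-filter≡sum-𝟙 P? (x ∷ xs) with does (P? x)
... | true  = cong suc (length-filter≡sum-𝟙 P? xs)
... | false = length-filter≡sum-𝟙 P? xs

solutions : (B : ℕ) → (ℕ → ℕ → ℕ) → ℕ → ℕ
solutions B f M = ∑ B λ x → ∑ B λ y → 𝟙 (f x y ≟ M)

pA≡solutions : ∀ a b M → pA a b M ≡ solutions (suc M) (λ x y → a * x + b * y) M
pA≡solutions a b M = trans (length-filter≡sum-𝟙 equation (cartesianProduct (upTo (suc M)) (upTo (suc M))))
                             (sum-map-upTo² (𝟙 ∘ equation) (suc M) (suc M))
  where
  equation : (t : ℕ × ℕ) → Dec (a * proj₁ t + b * proj₂ t ≡ M)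
  equation (x , y) = a * x + b * y ≟ M

N≡∑solutions : ∀ p q ℓ n →
  N p q ℓ n ≡ ∑ (suc n) λ z → solutions (suc n) (λ x y → p * x + q * y + ℓ * z) n
N≡∑solutions p q ℓ n = begin
  N p q ℓ n                                  ≡⟨ length-filter≡sum-𝟙 equation (cartesianProduct box pairs) ⟩
  sum (map (𝟙 ∘ equation) (cartesianProduct box pairs))
    ≡⟨ sum-map-cartesianProduct (𝟙 ∘ equation) box pairs ⟩
  sum (map (λ x → sum (map (λ yz → 𝟙 (equation (x , yz))) pairs)) box)
    ≡⟨ sum-map-upTo (λ x → sum (map (λ yz → 𝟙 (equation (x , yz))) pairs)) B ⟩
  ∑ B (λ x → sum (map (λ yz → 𝟙 (equation (x , yz))) pairs))
    ≡⟨ ∑-cong B (λ x _ → sum-map-upTo² (λ yz → 𝟙 (equation (x , yz))) B B) ⟩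
  ∑ B (λ x → ∑ B λ y → ∑ B λ z → E x y z)   ≡⟨ ∑-cong B (λ x _ → ∑-swap B B (E x)) ⟩
  ∑ B (λ x → ∑ B λ z → ∑ B λ y → E x y z)   ≡⟨ ∑-swap B B (λ x z → ∑ B λ y → E x y z) ⟩
  ∑ B (λ z → ∑ B λ x → ∑ B λ y → E x y z)   ∎
  where
  open ≡-Reasoning
  B : ℕ
  B = suc n
  box : List ℕ
  box = upTo B
  pairs : List (ℕ × ℕ)
  pairs = cartesianProduct box box
  equation : (t : ℕ × ℕ × ℕ) → Dec (p * proj₁ t + q * proj₁ (proj₂ t) + ℓ * proj₂ (proj₂ t) ≡ n)
  equation (x , y , z) = p * x + q * y + ℓ * z ≟ n
  E : ℕ → ℕ → ℕ → ℕ
  E x y z = 𝟙 (p * x + q * y + ℓ * z ≟ n)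

solutions-cong : ∀ B {f g M M′} → (∀ x y → f x y ≡ M ⇔ g x y ≡ M′) → solutions B f M ≡ solutions B g M′
solutions-cong B {f} {g} {M} {M′} f⇔g =
  ∑-cong B λ x _ → ∑-cong B λ y _ → 𝟙-cong (f⇔g x y) (f x y ≟ M) (g x y ≟ M′)

solutions-none : ∀ B {f M} → (∀ x y → f x y ≢ M) → solutions B f M ≡ 0
solutions-none B {f} {M} f≢M = ∑-zero B λ x _ → ∑-zero B λ y _ → 𝟙-no (f≢M x y) (f x y ≟ M)

solutions-truncate : ∀ {B₀ B f M} → B₀ ≤ B → (∀ x y → f x y ≡ M → x < B₀ × y < B₀) →
                     solutions B f M ≡ solutions B₀ f M
solutions-truncate {B₀} {B} {f} {M} B₀≤B bounded = begin
  ∑ B (λ x → ∑ B (row x))   ≡⟨ ∑-cong B (λ x _ → ∑-truncate B₀≤B (row-beyond x)) ⟩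
  ∑ B (λ x → ∑ B₀ (row x))  ≡⟨ ∑-truncate B₀≤B (λ x B₀≤x → ∑-zero B₀ λ y _ → row-vanishes x y B₀≤x) ⟩
  ∑ B₀ (λ x → ∑ B₀ (row x)) ∎
  where
  open ≡-Reasoning
  row : ℕ → ℕ → ℕ
  row x y = 𝟙 (f x y ≟ M)
  row-beyond : ∀ x y → B₀ ≤ y → row x y ≡ 0
  row-beyond x y B₀≤y = 𝟙-no (λ eq → <⇒≱ (proj₂ (bounded x y eq)) B₀≤y) (f x y ≟ M)
  row-vanishes : ∀ x y → B₀ ≤ x → row x y ≡ 0
  row-vanishes x y B₀≤x = 𝟙-no (λ eq → <⇒≱ (proj₁ (bounded x y eq)) B₀≤x) (f x y ≟ M)

solutions≡pA : ∀ a b .{{_ : NonZero a}} .{{_ : NonZero b}} {B M} → M < B →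
               solutions B (λ x y → a * x + b * y) M ≡ pA a b M
solutions≡pA a b {B} {M} M<B = trans (solutions-truncate M<B bounded) (sym (pA≡solutions a b M))
  where
  bounded : ∀ x y → a * x + b * y ≡ M → x < suc M × y < suc M
  bounded x y refl = s≤s (≤-trans (m≤n*m x a) (m≤m+n (a * x) (b * y)))
                   , s≤s (≤-trans (m≤n*m y b) (m≤n+m (b * y) (a * x)))

∣∧<⇒≡0 : ∀ {d m} → d ∣ℕ m → m < d → m ≡ 0
∣∧<⇒≡0 {m = zero}  _   _   = refl
∣∧<⇒≡0 {m = suc m} d∣m m<d = contradiction d∣m (>⇒∤ m<d)

∣+m-+n∣≡m∸n : ∀ {m n} → n ≤ m → ∣ (+ m - + n) ∣ ≡ m ∸ n
∣+m-+n∣≡m∸n {m} {n} n≤m = begin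
  ∣ (+ m - + n) ∣  ≡⟨ cong ∣_∣ (m-n≡m⊖n m n) ⟩
  ∣ m ⊖ n ∣        ≡⟨ ∣m⊖n∣≡∣n⊖m∣ m n ⟩
  ∣ n ⊖ m ∣        ≡⟨ ∣⊖∣-≤ n≤m ⟩
  m ∸ n            ∎
  where open ≡-Reasoning

module _ {d : ℕ} .{{_ : NonZero d}} where

  d∣m∸n⇒m%d≡n%d : ∀ {m n} → n ≤ m → d ∣ℕ m ∸ n → m % d ≡ n % d
  d∣m∸n⇒m%d≡n%d {m} {n} n≤m (divides k m∸n≡k*d) = begin
    m % d             ≡⟨ cong (_% d) (m+[n∸m]≡n n≤m) ⟨
    (n + (m ∸ n)) % d ≡⟨ cong (λ t → (n + t) % d) m∸n≡k*d ⟩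
    (n + k * d) % d   ≡⟨ [m+kn]%n≡m%n n k d ⟩
    n % d             ∎
    where open ≡-Reasoning

  m%d≡n%d⇒d∣m∸n : ∀ {m n} → n ≤ m → m % d ≡ n % d → d ∣ℕ m ∸ n
  m%d≡n%d⇒d∣m∸n {m} {n} n≤m m%d≡n%d = divides (m / d ∸ n / d) (begin
    m ∸ n                                       ≡⟨ cong₂ _∸_ (m≡m%n+[m/n]*n m d) (m≡m%n+[m/n]*n n d) ⟩
    (m % d + m / d * d) ∸ (n % d + n / d * d)
      ≡⟨ cong (λ t → (m % d + m / d * d) ∸ (t + n / d * d)) m%d≡n%d ⟨
    (m % d + m / d * d) ∸ (m % d + n / d * d)   ≡⟨ [m+n]∸[m+o]≡n∸o (m % d) _ _ ⟩
    m / d * d ∸ n / d * d                       ≡⟨ *-distribʳ-∸ d (m / d) (n / d) ⟨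
    (m / d ∸ n / d) * d                         ∎)
    where open ≡-Reasoning

  +d∣+m-+n⇒m%d≡n%d : ∀ {m n} → + d ∣ + m - + n → m % d ≡ n % d
  +d∣+m-+n⇒m%d≡n%d {m} {n} d∣m-n with ≤-total n m
  ... | inj₁ n≤m = d∣m∸n⇒m%d≡n%d n≤m (subst (d ∣ℕ_) (∣+m-+n∣≡m∸n n≤m) d∣m-n)
  ... | inj₂ m≤n = sym (d∣m∸n⇒m%d≡n%d m≤n (subst (d ∣ℕ_) ∣+m-+n∣≡n∸m d∣m-n))
    where
    ∣+m-+n∣≡n∸m : ∣ (+ m - + n) ∣ ≡ n ∸ m
    ∣+m-+n∣≡n∸m = trans (∣i-j∣≡∣j-i∣ (+ m) (+ n)) (∣+m-+n∣≡m∸n m≤n)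

  coprime⇒*-cancelˡ-%-≤ : ∀ {ℓ r j} → Coprime d ℓ → r < d → j ≤ r →
                          (ℓ * r) % d ≡ (ℓ * j) % d → r ≡ j
  coprime⇒*-cancelˡ-%-≤ {ℓ} {r} {j} d⊥ℓ r<d j≤r ℓr≡ℓj =
    ≤-antisym (m∸n≡0⇒m≤n (∣∧<⇒≡0 d∣r∸j (≤-<-trans (m∸n≤m r j) r<d))) j≤r
    where
    d∣ℓ*[r∸j] : d ∣ℕ ℓ * (r ∸ j)
    d∣ℓ*[r∸j] = subst (d ∣ℕ_) (sym (*-distribˡ-∸ ℓ r j))
                      (m%d≡n%d⇒d∣m∸n (*-monoʳ-≤ ℓ j≤r) ℓr≡ℓj)
    d∣r∸j : d ∣ℕ r ∸ j
    d∣r∸j = coprime-divisor d⊥ℓ d∣ℓ*[r∸j]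

  coprime⇒*-cancelˡ-% : ∀ {ℓ r j} → Coprime d ℓ → r < d → j < d →
                        (ℓ * r) % d ≡ (ℓ * j) % d → r ≡ j
  coprime⇒*-cancelˡ-% {r = r} {j} d⊥ℓ r<d j<d ℓr≡ℓj with ≤-total j r
  ... | inj₁ j≤r = coprime⇒*-cancelˡ-%-≤ d⊥ℓ r<d j≤r ℓr≡ℓj
  ... | inj₂ r≤j = sym (coprime⇒*-cancelˡ-%-≤ d⊥ℓ j<d r≤j (sym ℓr≡ℓj))

[t+c]*u+e≡m*u+e⇔t≡m∸c : ∀ {t c m} u .{{_ : NonZero u}} e → c ≤ m →
                         (t + c) * u + e ≡ m * u + e ⇔ t ≡ m ∸ c
[t+c]*u+e≡m*u+e⇔t≡m∸c {t} {c} {m} u e c≤m = mk⇔ to from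
  where
  to : (t + c) * u + e ≡ m * u + e → t ≡ m ∸ c
  to eq = trans (sym (m+n∸n≡m t c)) (cong (_∸ c) (*-cancelʳ-≡ (t + c) m u (+-cancelʳ-≡ e _ _ eq)))
  from : t ≡ m ∸ c → (t + c) * u + e ≡ m * u + e
  from refl = cong (λ s → s * u + e) (m∸n+n≡m c≤m)

a*u*x+b*u*y+ℓ*[k*u+r]≡[a*x+b*y+ℓ*k]*u+ℓ*r : ∀ a b u ℓ x y k r →
  a * u * x + b * u * y + ℓ * (k * u + r) ≡ (a * x + b * y + ℓ * k) * u + ℓ * r
a*u*x+b*u*y+ℓ*[k*u+r]≡[a*x+b*y+ℓ*k]*u+ℓ*r = solve-∀

m/n<o⇒m<o*n : ∀ {m n o} .{{_ : NonZero n}} → m / n < o → m < o * n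
m/n<o⇒m<o*n {m} {n} {o} m/n<o = ≰⇒> λ o*n≤m →
  <⇒≱ m/n<o (≤-trans (≤-reflexive (sym (m*n/n≡m o n))) (/-monoˡ-≤ n o*n≤m))

m≤n/o⇒o*m≤n : ∀ {m n o} .{{_ : NonZero o}} → m ≤ n / o → o * m ≤ n
m≤n/o⇒o*m≤n {m} {n} {o} m≤n/o = begin
  o * m      ≡⟨ *-comm o m ⟩
  m * o      ≤⟨ *-monoˡ-≤ o m≤n/o ⟩
  n / o * o  ≤⟨ m/n*n≤m n o ⟩
  n          ∎
  where open ≤-Reasoning

div≡/ : ∀ m n .{{_ : NonZero n}} → m div n ≡ m / n
div≡/ m (suc n) = refl

RHS-≰ : ∀ u a b ℓ n j → ¬ ℓ * j ≤ n → RHS u a b ℓ n j ≡ 0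
RHS-≰ u a b ℓ n j ℓj≰n = cong (λ t → if t then sum-for-ℓj≤n else 0) (dec-false (ℓ * j ≤? n) ℓj≰n)
  where
  X sum-for-ℓj≤n : ℕ
  X = n ∸ ℓ * j
  sum-for-ℓj≤n = sumTo (X div (u * ℓ)) (λ k → pA a b (X div u ∸ ℓ * k))

RHS-≤ : ∀ u a b ℓ n j .{{_ : NonZero u}} .{{_ : NonZero ℓ}} → ℓ * j ≤ n →
        RHS u a b ℓ n j ≡ sumTo ((n ∸ ℓ * j) / u / ℓ) (λ k → pA a b ((n ∸ ℓ * j) / u ∸ ℓ * k))
RHS-≤ u a b ℓ n j ℓj≤n = begin
  RHS u a b ℓ n j
    ≡⟨ cong (λ t → if t then sum-for-ℓj≤n else 0) (dec-true (ℓ * j ≤? n) ℓj≤n) ⟩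
  sum-for-ℓj≤n
    ≡⟨ cong₂ (λ K m → sumTo K (λ k → pA a b (m ∸ ℓ * k))) X/uℓ≡X/u/ℓ (div≡/ X u) ⟩
  sumTo (X / u / ℓ) (λ k → pA a b (X / u ∸ ℓ * k))
    ∎
  where
  open ≡-Reasoning
  X sum-for-ℓj≤n : ℕ
  X = n ∸ ℓ * j
  sum-for-ℓj≤n = sumTo (X div (u * ℓ)) (λ k → pA a b (X div u ∸ ℓ * k))
  instance
    uℓ≢0 : NonZero (u * ℓ)
    uℓ≢0 = m*n≢0 u ℓ
  X/uℓ≡X/u/ℓ : X div (u * ℓ) ≡ X / u / ℓ
  X/uℓ≡X/u/ℓ = trans (div≡/ X (u * ℓ)) (sym (m/n/o≡m/[n*o] X u ℓ))

module Fibres (a b u ℓ n : ℕ)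
              {{_ : NonZero a}} {{_ : NonZero b}} {{_ : NonZero u}} {{_ : NonZero ℓ}} where

  fibre : ℕ → ℕ
  fibre z = solutions (suc n) (λ x y → a * u * x + b * u * y + ℓ * z) n

  regroup : ∀ x y k r → a * u * x + b * u * y + ℓ * (k * u + r) ≡ (a * x + b * y + ℓ * k) * u + ℓ * r
  regroup = a*u*x+b*u*y+ℓ*[k*u+r]≡[a*x+b*y+ℓ*k]*u+ℓ*r a b u ℓ

  n≡mu+ℓj⇒m≤n : ∀ {m j} → n ≡ m * u + ℓ * j → m ≤ n
  n≡mu+ℓj⇒m≤n {m} {j} n≡mu+ℓj =
    subst (m ≤_) (sym n≡mu+ℓj) (≤-trans (m≤m*n m u) (m≤m+n (m * u) (ℓ * j)))

  fibre-beyond : ∀ {z} → n < ℓ * z → fibre z ≡ 0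
  fibre-beyond {z} n<ℓz = solutions-none (suc n) λ x y eq →
    <⇒≱ n<ℓz (subst (ℓ * z ≤_) eq (m≤n+m (ℓ * z) (a * u * x + b * u * y)))

  fibre-off-residue : ∀ {j} → Coprime u ℓ → j < u → n % u ≡ (ℓ * j) % u →
                      ∀ k r → r < u → r ≢ j → fibre (k * u + r) ≡ 0
  fibre-off-residue {j} u⊥ℓ j<u n≡ℓj k r r<u r≢j = solutions-none (suc n) λ x y eq →
    r≢j (coprime⇒*-cancelˡ-% u⊥ℓ r<u j<u (begin
      (ℓ * r) % u                              ≡⟨ [m+kn]%n≡m%n (ℓ * r) (a * x + b * y + ℓ * k) u ⟨
      (ℓ * r + (a * x + b * y + ℓ * k) * u) % u ≡⟨ cong (_% u) (+-comm (ℓ * r) _) ⟩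
      ((a * x + b * y + ℓ * k) * u + ℓ * r) % u ≡⟨ cong (_% u) (trans (sym (regroup x y k r)) eq) ⟩
      n % u                                    ≡⟨ n≡ℓj ⟩
      (ℓ * j) % u                              ∎))
    where open ≡-Reasoning

  fibre-on-residue : ∀ {m j k} → n ≡ m * u + ℓ * j → ℓ * k ≤ m →
                     fibre (k * u + j) ≡ pA a b (m ∸ ℓ * k)
  fibre-on-residue {m} {j} {k} n≡mu+ℓj ℓk≤m = begin
    fibre (k * u + j)                                      ≡⟨ solutions-cong (suc n) reduced ⟩
    solutions (suc n) (λ x y → a * x + b * y) (m ∸ ℓ * k)  ≡⟨ solutions≡pA a b m∸ℓk<1+n ⟩
    pA a b (m ∸ ℓ * k)                                     ∎
    where
    open ≡-Reasoning
    m∸ℓk<1+n : m ∸ ℓ * k < suc n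
    m∸ℓk<1+n = s≤s (≤-trans (m∸n≤m m (ℓ * k)) (n≡mu+ℓj⇒m≤n n≡mu+ℓj))
    reduced : ∀ x y → a * u * x + b * u * y + ℓ * (k * u + j) ≡ n ⇔ a * x + b * y ≡ m ∸ ℓ * k
    reduced x y = mk⇔ (to ∘ λ eq → trans (sym (regroup x y k j)) (trans eq n≡mu+ℓj))
                      (λ eq → trans (regroup x y k j) (trans (from eq) (sym n≡mu+ℓj)))
      where open Equivalence ([t+c]*u+e≡m*u+e⇔t≡m∸c u (ℓ * j) ℓk≤m)

  N≡∑fibre-on-residue : ∀ {j} → Coprime u ℓ → j < u → n % u ≡ (ℓ * j) % u →
                        N (a * u) (b * u) ℓ n ≡ ∑ (suc n) (λ k → fibre (k * u + j))
  N≡∑fibre-on-residue {j} u⊥ℓ j<u n≡ℓj = begin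
    N (a * u) (b * u) ℓ n                 ≡⟨ N≡∑solutions (a * u) (b * u) ℓ n ⟩
    ∑ (suc n) fibre                       ≡⟨ ∑-truncate (m≤m*n (suc n) u) beyond ⟨
    ∑ (suc n * u) fibre                   ≡⟨ ∑-residue (suc n) j<u (fibre-off-residue u⊥ℓ j<u n≡ℓj) ⟩
    ∑ (suc n) (λ k → fibre (k * u + j))   ∎
    where
    open ≡-Reasoning
    beyond : ∀ z → suc n ≤ z → fibre z ≡ 0
    beyond z n<z = fibre-beyond (<-≤-trans n<z (m≤n*m z ℓ))

  ∑fibre-on-residue≡0 : ∀ {j} → n < ℓ * j → ∑ (suc n) (λ k → fibre (k * u + j)) ≡ 0
  ∑fibre-on-residue≡0 {j} n<ℓj = ∑-zero (suc n) λ k _ →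
    fibre-beyond (<-≤-trans n<ℓj (*-monoʳ-≤ ℓ (m≤n+m j (k * u))))

  n<ℓ*[k*u+j] : ∀ {m j k} → n ≡ m * u + ℓ * j → m / ℓ < k → n < ℓ * (k * u + j)
  n<ℓ*[k*u+j] {m} {j} {k} n≡mu+ℓj m/ℓ<k = begin-strict
    n                  ≡⟨ n≡mu+ℓj ⟩
    m * u + ℓ * j      <⟨ +-monoˡ-< (ℓ * j) (*-monoˡ-< u (m/n<o⇒m<o*n m/ℓ<k)) ⟩
    k * ℓ * u + ℓ * j  ≡⟨ k*ℓ*u+ℓ*j≡ℓ*[k*u+j] k ℓ u j ⟩
    ℓ * (k * u + j)    ∎
    where
    open ≤-Reasoning
    k*ℓ*u+ℓ*j≡ℓ*[k*u+j] : ∀ k ℓ u j → k * ℓ * u + ℓ * j ≡ ℓ * (k * u + j)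
    k*ℓ*u+ℓ*j≡ℓ*[k*u+j] = solve-∀

  ∑fibre-on-residue≡sumTo : ∀ {m j} → n ≡ m * u + ℓ * j →
    ∑ (suc n) (λ k → fibre (k * u + j)) ≡ sumTo (m / ℓ) (λ k → pA a b (m ∸ ℓ * k))
  ∑fibre-on-residue≡sumTo {m} {j} n≡mu+ℓj = begin
    ∑ (suc n) (λ k → fibre (k * u + j))     ≡⟨ ∑-truncate (s≤s K≤n) beyond ⟩
    ∑ (suc K) (λ k → fibre (k * u + j))     ≡⟨ ∑-cong (suc K) (λ k k<1+K → fibre-on-residue n≡mu+ℓj (m≤n/o⇒o*m≤n (≤-pred k<1+K))) ⟩
    ∑ (suc K) (λ k → pA a b (m ∸ ℓ * k))    ≡⟨ sum-map-upTo (λ k → pA a b (m ∸ ℓ * k)) (suc K) ⟨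
    sumTo K (λ k → pA a b (m ∸ ℓ * k))      ∎
    where
    open ≡-Reasoning
    K : ℕ
    K = m / ℓ
    K≤n : K ≤ n
    K≤n = ≤-trans (m/n≤m m ℓ) (n≡mu+ℓj⇒m≤n n≡mu+ℓj)
    beyond : ∀ k → suc K ≤ k → fibre (k * u + j) ≡ 0
    beyond k K<k = fibre-beyond (n<ℓ*[k*u+j] n≡mu+ℓj K<k)

  N≡RHS : ∀ {j} → Coprime u ℓ → j < u → n % u ≡ (ℓ * j) % u →
          N (a * u) (b * u) ℓ n ≡ RHS u a b ℓ n j
  N≡RHS {j} u⊥ℓ j<u n≡ℓj with ℓ * j ≤? n
  ... | no ℓj≰n = begin
    N (a * u) (b * u) ℓ n                  ≡⟨ N≡∑fibre-on-residue u⊥ℓ j<u n≡ℓj ⟩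
    ∑ (suc n) (λ k → fibre (k * u + j))    ≡⟨ ∑fibre-on-residue≡0 (≰⇒> ℓj≰n) ⟩
    0                                      ≡⟨ RHS-≰ u a b ℓ n j ℓj≰n ⟨
    RHS u a b ℓ n j                        ∎
    where open ≡-Reasoning
  ... | yes ℓj≤n = begin
    N (a * u) (b * u) ℓ n                  ≡⟨ N≡∑fibre-on-residue u⊥ℓ j<u n≡ℓj ⟩
    ∑ (suc n) (λ k → fibre (k * u + j))    ≡⟨ ∑fibre-on-residue≡sumTo n≡mu+ℓj ⟩
    sumTo (m / ℓ) (λ k → pA a b (m ∸ ℓ * k)) ≡⟨ RHS-≤ u a b ℓ n j ℓj≤n ⟨
    RHS u a b ℓ n j                        ∎
    where
    open ≡-Reasoning
    m : ℕ
    m = (n ∸ ℓ * j) / u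
    n≡mu+ℓj : n ≡ m * u + ℓ * j
    n≡mu+ℓj = trans (sym (m∸n+n≡m ℓj≤n)) (cong (_+ ℓ * j) (sym (m/n*n≡m u∣n∸ℓj)))
      where
      u∣n∸ℓj : u ∣ℕ n ∸ ℓ * j
      u∣n∸ℓj = m%d≡n%d⇒d∣m∸n ℓj≤n n≡ℓj

div*≡ : ∀ {d m} .{{_ : NonZero d}} → d ∣ℕ m → m div d * d ≡ m
div*≡ {suc _} d∣m = m/n*n≡m d∣m

div>0 : ∀ {d m} .{{_ : NonZero d}} → d ∣ℕ m → 0 < m → 0 < m div d
div>0 {suc _} d∣m 0<m = m≥n⇒m/n>0 (∣⇒≤ {{>-nonZero 0<m}} d∣m)

theorem2p1 : (p q ℓ n : ℕ) → 0 < p → 0 < q → 0 < ℓ → 0 < n →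
    p ≤ q → q ≤ ℓ → gcd (gcd p q) ℓ ≡ 1 →
    (j : ℕ) → j < gcd p q → (+ gcd p q) ∣ (+ n - + (ℓ * j)) →
    N p q ℓ n ≡ RHS (gcd p q) (p div gcd p q) (q div gcd p q) ℓ n j
theorem2p1 p q ℓ n 0<p 0<q 0<ℓ _ _ _ gcd≡1 j j<u u∣n-ℓj = begin
  N p q ℓ n              ≡⟨ cong₂ (λ p′ q′ → N p′ q′ ℓ n) (div*≡ u∣p) (div*≡ u∣q) ⟨
  N (a * u) (b * u) ℓ n  ≡⟨ Fibres.N≡RHS a b u ℓ n u⊥ℓ j<u (+d∣+m-+n⇒m%d≡n%d u∣n-ℓj) ⟩
  RHS u a b ℓ n j        ∎
  where
  open ≡-Reasoning
  u a b : ℕ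
  u = gcd p q
  a = p div u
  b = q div u
  u∣p : u ∣ℕ p
  u∣p = gcd[m,n]∣m p q
  u∣q : u ∣ℕ q
  u∣q = gcd[m,n]∣n p q
  u⊥ℓ : Coprime u ℓ
  u⊥ℓ = gcd≡1⇒coprime gcd≡1
  instance
    u≢0 : NonZero u
    u≢0 = ≢-nonZero (gcd[m,n]≢0 p q (inj₁ (≢-nonZero⁻¹ p {{>-nonZero 0<p}})))
    a≢0 : NonZero a
    a≢0 = >-nonZero (div>0 u∣p 0<p)
    b≢0 : NonZero b
    b≢0 = >-nonZero (div>0 u∣q 0<q)
    ℓ≢0 : NonZero ℓ
    ℓ≢0 = >-nonZero 0<ℓ
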